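{- Let $k\geq 1$ and let $G$ be a connected graph of order $n$ and diameter $d$. Then $$\gamma^r_k(G)\leq\begin{cases} n-d, & \text{if } d\leq k,\\ n-d+1, & \text{if } k+1\leq d\leq 2k,\\ n-d+\left\lfloor \frac{d}{2k+1}\right\rfloor, & \text{if } d\geq 2k+1.\end{cases}$$ These bounds are sharp: for every $k\ge1$ and each of the three cases, there is a graph (a path) attaining the bound.
   Context: For a graph $G=(V,E)$ and $k\geq 1$, a set $D\subseteq V$ is distance $k$-dominating if every $v\in V\setminus D$ is at distance at most $k$ from some vertex of $D$. An ordered set $W=\{w_1,\dots,w_r\}$ is a resolving set if for all distinct $u,v\in V\setminus W$ the distance vectors $(d_G(u,w_i))_i$ and $(d_G(v,w_i))_i$ differ. $\gamma^r_k(G)$ is the minimum cardinality of a set that is both resolving and distance $k$-dominating. The diameter is the maximum distance between two vertices. -}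

module Defs where

open import Data.Nat using (ℕ; zero; suc; _≤_; _≟_)
open import Data.Nat.Properties using (1+n≢n)
open import Data.Fin using (Fin; toℕ)
open import Data.Fin.Subset using (Subset; _∈_; _∉_)
open import Data.Product using (Σ; _×_; _,_; ∃; ∃-syntax)
open import Data.Sum using (_⊎_; inj₁; inj₂)
open import Relation.Nullary using (¬_; Dec; yes; no)
open import Relation.Nullary.Decidable using (_⊎-dec_)
open import Relation.Binary.PropositionalEquality using (_≡_; _≢_; sym)

record Graph (n : ℕ) : Set₁ where
  field
    Adj     : Fin n → Fin n → Set
    Adj?    : ∀ u v → Dec (Adj u v)
    symm    : ∀ {u v} → Adj u v → Adj v u
    irrefl  : ∀ {u} → ¬ Adj u u
open Graph public

data Walk {n : ℕ} (G : Graph n) : Fin n → Fin n → ℕ → Set where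
  nil  : ∀ {u} → Walk G u u 0
  cons : ∀ {u v w l} → Adj G u v → Walk G v w l → Walk G u w (suc l)

IsDist : ∀ {n} → Graph n → Fin n → Fin n → ℕ → Set
IsDist G u v e = Walk G u v e × (∀ m → Walk G u v m → e ≤ m)

Connected : ∀ {n} → Graph n → Set
Connected G = ∀ u v → ∃[ l ] Walk G u v l

Diameter : ∀ {n} → Graph n → ℕ → Set
Diameter {n} G d =
  (Σ (Fin n) λ u → Σ (Fin n) λ v → IsDist G u v d)
  × (∀ u v e → IsDist G u v e → e ≤ d)

DistKDominating : ∀ {n} → Graph n → ℕ → Subset n → Set
DistKDominating {n} G k D =
  ∀ v → v ∉ D → Σ (Fin n) λ w → Σ ℕ λ e → w ∈ D × IsDist G v w e × e ≤ k

Resolving : ∀ {n} → Graph n → Subset n → Set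
Resolving {n} G W =
  ∀ u v → u ∉ W → v ∉ W → u ≢ v →
    Σ (Fin n) λ w → Σ ℕ λ e₁ → Σ ℕ λ e₂ →
      w ∈ W × IsDist G u w e₁ × IsDist G v w e₂ × e₁ ≢ e₂

ResolvingKDominating : ∀ {n} → Graph n → ℕ → Subset n → Set
ResolvingKDominating G k D = Resolving G D × DistKDominating G k D

open Data.Fin.Subset using (∣_∣)
IsGammaRK : ∀ {n} → Graph n → ℕ → ℕ → Set
IsGammaRK {n} G k m =
  (Σ (Subset n) λ D → ResolvingKDominating G k D × ∣ D ∣ ≡ m)
  × (∀ D → ResolvingKDominating G k D → m ≤ ∣ D ∣)

PathAdj : ∀ {n} → Fin n → Fin n → Set
PathAdj i j = toℕ j ≡ suc (toℕ i) ⊎ toℕ i ≡ suc (toℕ j)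

Path : (n : ℕ) → Graph n
Path n = record
  { Adj    = PathAdj
  ; Adj?   = λ i j → (toℕ j ≟ suc (toℕ i)) ⊎-dec (toℕ i ≟ suc (toℕ j))
  ; symm   = λ { (inj₁ p) → inj₂ p ; (inj₂ p) → inj₁ p }
  ; irrefl = λ { (inj₁ p) → 1+n≢n (sym p) ; (inj₂ p) → 1+n≢n (sym p) }
  }

{-# OPTIONS --safe #-}
-- Let x₀, …, x_d be a diametral path; as a geodesic it has d(xᵢ, xⱼ) = |i − j|.
-- Deleting from V every xᵢ with i outside a set K ⊆ {0, …, d} leaves a set whose
-- complement lies on the path, so it is resolving and distance k-dominating as soon
-- as K resolves and k-dominates the line {0, …, d}. Take K = {0} if d ≤ k,
-- K = {0, d} if d ≤ 2k, and otherwise the centres of consecutive blocks of 2k + 1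
-- positions, the last short block being served by a single point: ⌊d/(2k+1)⌋ + 1
-- points, among which the dominators of the two ends are distinct once d ≥ 2k + 1,
-- and two distinct points resolve a line. The paths on 1, k + 2 and 2k + 2 vertices
-- attain the bounds, since there a single vertex cannot both dominate the two ends
-- and separate the two neighbours of an interior vertex.
module Submission where

open import Defs
open import Data.Nat using (ℕ; zero; suc; _+_; _*_; _∸_; _≤_; _<_; _/_; _%_; _⊓_; _⊔_; _≡ᵇ_; z≤n; s≤s; ∣_-_∣)
open import Data.Nat.Properties
open import Data.Nat.DivMod using (m≡m%n+[m/n]*n; m%n<n; n/n≡1)
open import Data.Bool using (Bool; true; false; not; _∨_; if_then_else_)
open import Data.Bool.Properties using (∨-zeroʳ)
open import Data.Fin as Fin using (Fin; toℕ; fromℕ; fromℕ<; inject₁)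
open import Data.Fin.Properties using (toℕ-injective; toℕ<n; toℕ-fromℕ; toℕ-fromℕ<; toℕ-inject₁)
open import Data.Fin.Subset using (Subset; ∣_∣; ⊥; ⁅_⁆; _∪_; ∁; _∈_; _∉_; _⊆_)
open import Data.Fin.Subset.Properties using (∉⊥; _∈?_; x∈⁅x⁆; x∈⁅y⁆⇒x≡y; ∣⁅x⁆∣≡1; x∈p∪q⁻; x∈p∪q⁺; q⊆p∪q; p⊆q⇒∣p∣≤∣q∣; p⊂q⇒∣p∣<∣q∣; ∣∁p∣≡n∸∣p∣; x∉∁p⇒x∈p; x∉p⇒x∈∁p)
open import Data.Product using (Σ; _×_; _,_; proj₁; proj₂; ∃-syntax)
open import Data.Sum using (inj₁; inj₂)
open import Function using (_∘_)
open import Relation.Nullary using (yes; no; contradiction)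
open import Relation.Binary.PropositionalEquality using (_≡_; _≢_; refl; sym; trans; cong; cong₂; subst; module ≡-Reasoning)

count : (ℕ → Bool) → ℕ → ℕ
count f zero    = 0
count f (suc t) = if f 0 then suc (count (f ∘ suc) t) else count (f ∘ suc) t

count-complement : ∀ f t → count f t + count (not ∘ f) t ≡ t
count-complement f zero = refl
count-complement f (suc t) with f 0
... | true  = cong suc (count-complement (f ∘ suc) t)
... | false = trans (+-suc _ _) (cong suc (count-complement (f ∘ suc) t))

count-not : ∀ f t → count (not ∘ f) t ≡ t ∸ count f t
count-not f t = begin
  count (not ∘ f) t                           ≡⟨ m+n∸m≡n (count f t) _ ⟨
  count f t + count (not ∘ f) t ∸ count f t   ≡⟨ cong (_∸ count f t) (count-complement f t) ⟩
  t ∸ count f t                               ∎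
  where open ≡-Reasoning

count-∨ : ∀ f g t → count (λ i → f i ∨ g i) t ≤ count f t + count g t
count-∨ f g zero = z≤n
count-∨ f g (suc t) with f 0 | g 0 | count-∨ (f ∘ suc) (g ∘ suc) t
... | true  | true  | ih = s≤s (≤-trans ih (+-monoʳ-≤ _ (n≤1+n _)))
... | true  | false | ih = s≤s ih
... | false | true  | ih = ≤-trans (s≤s ih) (≤-reflexive (sym (+-suc _ _)))
... | false | false | ih = ih

count-false : ∀ t → count (λ _ → false) t ≡ 0
count-false zero    = refl
count-false (suc t) = count-false t

count-≡ᵇ : ∀ a t → count (_≡ᵇ a) t ≤ 1
count-≡ᵇ a       zero    = z≤n
count-≡ᵇ zero    (suc t) = s≤s (≤-reflexive (count-false t))
count-≡ᵇ (suc a) (suc t) = count-≡ᵇ a t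

≡ᵇ-refl : ∀ n → (n ≡ᵇ n) ≡ true
≡ᵇ-refl zero    = refl
≡ᵇ-refl (suc n) = ≡ᵇ-refl n

shift : ℕ → (ℕ → Bool) → ℕ → Bool
shift zero    f i       = f i
shift (suc m) f zero    = false
shift (suc m) f (suc i) = shift m f i

shift-+ : ∀ m f i → shift m f (m + i) ≡ f i
shift-+ zero    f i = refl
shift-+ (suc m) f i = shift-+ m f i

count-shift : ∀ m f t → count (shift m f) (m + t) ≡ count f t
count-shift zero    f t = refl
count-shift (suc m) f t = count-shift m f t

∣m-n∣≤n : ∀ {m n} → m ≤ 2 * n → ∣ m - n ∣ ≤ n
∣m-n∣≤n {m} {n} m≤2n with ≤-total m n
... | inj₁ m≤n = subst (_≤ n) (sym (m≤n⇒∣m-n∣≡n∸m m≤n)) (m∸n≤m n m)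
... | inj₂ n≤m = subst (_≤ n) (sym (m≤n⇒∣n-m∣≡n∸m n≤m))
                   (m≤n+o⇒m∸n≤o m n (subst (m ≤_) (cong (n +_) (+-identityʳ n)) m≤2n))

a∸i≡j∸a⇒i+j≡2a : ∀ {i j a} → i ≤ a → a ≤ j → a ∸ i ≡ j ∸ a → i + j ≡ 2 * a
a∸i≡j∸a⇒i+j≡2a {i} {j} {a} i≤a a≤j eq = begin
  i + j                 ≡⟨ cong (i +_) (m∸n+n≡m a≤j) ⟨
  i + ((j ∸ a) + a)     ≡⟨ cong (λ z → i + (z + a)) eq ⟨
  i + ((a ∸ i) + a)     ≡⟨ +-assoc i (a ∸ i) a ⟨
  (i + (a ∸ i)) + a     ≡⟨ cong (_+ a) (m+[n∸m]≡n i≤a) ⟩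
  a + a                 ≡⟨ cong (a +_) (+-identityʳ a) ⟨
  2 * a                 ∎
  where open ≡-Reasoning

equidistant⇒i+j≡2a : ∀ {i j a} → i ≢ j → ∣ i - a ∣ ≡ ∣ j - a ∣ → i + j ≡ 2 * a
equidistant⇒i+j≡2a {i} {j} {a} i≢j eq with ≤-total i a | ≤-total j a
... | inj₁ i≤a | inj₁ j≤a = contradiction
  (∸-cancelˡ-≡ i≤a j≤a (trans (sym (m≤n⇒∣m-n∣≡n∸m i≤a)) (trans eq (m≤n⇒∣m-n∣≡n∸m j≤a)))) i≢j
... | inj₂ a≤i | inj₂ a≤j = contradiction
  (∸-cancelʳ-≡ a≤i a≤j (trans (sym (m≤n⇒∣n-m∣≡n∸m a≤i)) (trans eq (m≤n⇒∣n-m∣≡n∸m a≤j)))) i≢j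
... | inj₁ i≤a | inj₂ a≤j =
  a∸i≡j∸a⇒i+j≡2a i≤a a≤j (trans (sym (m≤n⇒∣m-n∣≡n∸m i≤a)) (trans eq (m≤n⇒∣n-m∣≡n∸m a≤j)))
... | inj₂ a≤i | inj₁ j≤a = trans (+-comm i j)
  (a∸i≡j∸a⇒i+j≡2a j≤a a≤i (trans (sym (m≤n⇒∣m-n∣≡n∸m j≤a)) (trans (sym eq) (m≤n⇒∣n-m∣≡n∸m a≤i))))

m∸[n∸o]≤m∸n+o : ∀ m n o → m ∸ (n ∸ o) ≤ m ∸ n + o
m∸[n∸o]≤m∸n+o m n o = m≤n+o⇒m∸n≤o m (n ∸ o) (begin
  m                          ≤⟨ m≤n+m∸n m n ⟩
  n + (m ∸ n)                ≤⟨ +-monoˡ-≤ (m ∸ n) (m≤n+m∸n n o) ⟩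
  (o + (n ∸ o)) + (m ∸ n)    ≡⟨ cong (_+ (m ∸ n)) (+-comm o (n ∸ o)) ⟩
  ((n ∸ o) + o) + (m ∸ n)    ≡⟨ +-assoc (n ∸ o) o (m ∸ n) ⟩
  (n ∸ o) + (o + (m ∸ n))    ≡⟨ cong ((n ∸ o) +_) (+-comm o (m ∸ n)) ⟩
  (n ∸ o) + (m ∸ n + o)      ∎)
  where open ≤-Reasoning

Dominates : ℕ → (ℕ → Bool) → ℕ → Set
Dominates k K d = ∀ i → i ≤ d → ∃[ p ] p ≤ d × K p ≡ true × ∣ i - p ∣ ≤ k

Resolves : (ℕ → Bool) → ℕ → Set
Resolves K d =
  ∀ i j → i ≤ d → j ≤ d → i ≢ j → ∃[ c ] c ≤ d × K c ≡ true × ∣ i - c ∣ ≢ ∣ j - c ∣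

record LinePattern (k d c : ℕ) : Set where
  field
    kept       : ℕ → Bool
    few        : count kept (suc d) ≤ suc c
    dominating : Dominates k kept d
    resolving  : Resolves kept d

resolves-by-0 : ∀ {K d} → K 0 ≡ true → Resolves K d
resolves-by-0 K0 i j _ _ i≢j =
  0 , z≤n , K0 , λ eq → i≢j (trans (sym (∣-∣-identityʳ i)) (trans eq (∣-∣-identityʳ j)))

resolves-by-two : ∀ {K d a b} → a ≤ d → b ≤ d → a ≢ b → K a ≡ true → K b ≡ true → Resolves K d
resolves-by-two {a = a} {b} a≤d b≤d a≢b Ka Kb i j _ _ i≢j with ∣ i - a ∣ ≟ ∣ j - a ∣
... | no  differ = a , a≤d , Ka , differ
... | yes same   = b , b≤d , Kb , λ sameᵇ → a≢b (*-cancelˡ-≡ a b 2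
        (trans (sym (equidistant⇒i+j≡2a i≢j same)) (equidistant⇒i+j≡2a i≢j sameᵇ)))

near-pattern : ∀ {k d} → d ≤ k → LinePattern k d 0
near-pattern {d = d} d≤k = record
  { kept       = _≡ᵇ 0
  ; few        = count-≡ᵇ 0 (suc d)
  ; dominating = λ i i≤d → 0 , z≤n , refl , subst (_≤ _) (sym (∣-∣-identityʳ i)) (≤-trans i≤d d≤k)
  ; resolving  = resolves-by-0 refl
  }

middle-pattern : ∀ {k d} → d ≤ 2 * k → LinePattern k d 1
middle-pattern {k} {d} d≤2k = record
  { kept       = ends
  ; few        = ≤-trans (count-∨ (_≡ᵇ 0) (_≡ᵇ d) (suc d)) (+-mono-≤ (count-≡ᵇ 0 (suc d)) (count-≡ᵇ d (suc d)))
  ; dominating = dominating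
  ; resolving  = resolves-by-0 refl
  }
  where
  ends : ℕ → Bool
  ends i = (i ≡ᵇ 0) ∨ (i ≡ᵇ d)

  dominating : Dominates k ends d
  dominating i i≤d with i ≤? k
  ... | yes i≤k = 0 , z≤n , refl , subst (_≤ k) (sym (∣-∣-identityʳ i)) i≤k
  ... | no  i≰k = d , ≤-refl , trans (cong ((d ≡ᵇ 0) ∨_) (≡ᵇ-refl d)) (∨-zeroʳ _) ,
    subst (_≤ k) (sym (m≤n⇒∣m-n∣≡n∸m i≤d)) (m≤n+o⇒m∸n≤o d i (begin
      d          ≤⟨ d≤2k ⟩
      k + (k + 0) ≤⟨ +-monoˡ-≤ (k + 0) (<⇒≤ (≰⇒> i≰k)) ⟩
      i + (k + 0) ≡⟨ cong (i +_) (+-identityʳ k) ⟩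
      i + k       ∎))
    where open ≤-Reasoning

point-dominates : ∀ {k d} → d ≤ 2 * k → Dominates k (_≡ᵇ (k ⊓ d)) d
point-dominates {k} {d} d≤2k i i≤d = k ⊓ d , m⊓n≤n k d , ≡ᵇ-refl (k ⊓ d) , close
  where
  close : ∣ i - k ⊓ d ∣ ≤ k
  close with ≤-total k d
  ... | inj₁ k≤d rewrite m≤n⇒m⊓n≡m k≤d = ∣m-n∣≤n (≤-trans i≤d d≤2k)
  ... | inj₂ d≤k rewrite m≥n⇒m⊓n≡n d≤k =
    subst (_≤ k) (sym (m≤n⇒∣m-n∣≡n∸m i≤d)) (≤-trans (m∸n≤m d i) d≤k)

prepend-block : ℕ → (ℕ → Bool) → ℕ → Bool
prepend-block k K i = (i ≡ᵇ k) ∨ shift (suc (2 * k)) K i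

count-prepend-block : ∀ k K d → count (prepend-block k K) (suc (suc (2 * k) + d)) ≤ suc (count K (suc d))
count-prepend-block k K d = begin
  count (prepend-block k K) (suc (m + d))                        ≤⟨ count-∨ (_≡ᵇ k) (shift m K) (suc (m + d)) ⟩
  count (_≡ᵇ k) (suc (m + d)) + count (shift m K) (suc (m + d))  ≤⟨ +-monoˡ-≤ _ (count-≡ᵇ k (suc (m + d))) ⟩
  1 + count (shift m K) (suc (m + d))                            ≡⟨ cong (λ t → 1 + count (shift m K) t) (+-suc m d) ⟨
  1 + count (shift m K) (m + suc d)                              ≡⟨ cong (1 +_) (count-shift m K (suc d)) ⟩
  suc (count K (suc d))                                          ∎
  where
  open ≤-Reasoning
  m : ℕ
  m = suc (2 * k)

shift-dominates : ∀ {k K d} m → Dominates k K d →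
  ∀ i → m ≤ i → i ≤ m + d → ∃[ p ] p ≤ m + d × shift m K p ≡ true × ∣ i - p ∣ ≤ k
shift-dominates {K = K} m dom i m≤i i≤ with dom (i ∸ m) (m≤n+o⇒m∸n≤o i m i≤)
... | p , p≤d , Kp , close = m + p , +-monoʳ-≤ m p≤d , trans (shift-+ m K p) Kp ,
  subst (_≤ _) (sym distance) close
  where
  distance : ∣ i - m + p ∣ ≡ ∣ i ∸ m - p ∣
  distance = trans (cong (λ z → ∣ z - m + p ∣) (sym (m+[n∸m]≡n m≤i))) (∣m+n-m+o∣≡∣n-o∣ m (i ∸ m) p)

prepend-block-dominates : ∀ {k K d} → Dominates k K d → Dominates k (prepend-block k K) (suc (2 * k) + d)
prepend-block-dominates {k} {K} {d} dom i i≤ with i ≤? 2 * k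
... | yes i≤2k = k , ≤-trans (m≤m+n k (k + 0)) (≤-trans (n≤1+n (2 * k)) (m≤m+n _ d)) ,
                 cong (_∨ shift (suc (2 * k)) K k) (≡ᵇ-refl k) , ∣m-n∣≤n i≤2k
... | no  i≰2k with shift-dominates (suc (2 * k)) dom i (≰⇒> i≰2k) i≤
...   | p , p≤ , Kp , close = p , p≤ , trans (cong ((p ≡ᵇ k) ∨_) Kp) (∨-zeroʳ _) , close

block-cover : ∀ k q d → d ≤ q * suc (2 * k) + 2 * k →
  ∃[ K ] count K (suc d) ≤ suc q × Dominates k K d
block-cover k q d d≤ with d ≤? 2 * k
block-cover k q       d d≤ | yes d≤2k =
  (_≡ᵇ (k ⊓ d)) , ≤-trans (count-≡ᵇ (k ⊓ d) (suc d)) (s≤s z≤n) , point-dominates d≤2k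
block-cover k zero    d d≤ | no  d≰2k = contradiction d≤ d≰2k
block-cover k (suc q) d d≤ | no  d≰2k
  with block-cover k q (d ∸ suc (2 * k))
         (m≤n+o⇒m∸n≤o d (suc (2 * k)) (subst (d ≤_) (+-assoc (suc (2 * k)) (q * suc (2 * k)) (2 * k)) d≤))
... | K , few , dom =
  subst (λ e → ∃[ K ] count K (suc e) ≤ suc (suc q) × Dominates k K e) (m+[n∸m]≡n (≰⇒> d≰2k))
    (prepend-block k K , ≤-trans (count-prepend-block k K _) (s≤s few) , prepend-block-dominates dom)

d≤[d/m]*m+2k : ∀ k d → d ≤ d / suc (2 * k) * suc (2 * k) + 2 * k
d≤[d/m]*m+2k k d = begin
  d                     ≡⟨ m≡m%n+[m/n]*n d m ⟩
  d % m + d / m * m     ≤⟨ +-monoˡ-≤ (d / m * m) (≤-pred (m%n<n d m)) ⟩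
  2 * k + d / m * m     ≡⟨ +-comm (2 * k) (d / m * m) ⟩
  d / m * m + 2 * k     ∎
  where
  open ≤-Reasoning
  m : ℕ
  m = suc (2 * k)

ends-dominators-differ : ∀ {k d p₀ pₑ} → suc (2 * k) ≤ d → p₀ ≤ k → ∣ d - pₑ ∣ ≤ k → p₀ ≢ pₑ
ends-dominators-differ {k} {d} {pₑ = pₑ} m≤d p₀≤k close refl = <⇒≱ m≤d (begin
  d              ≤⟨ m≤n+∣m-n∣ d pₑ ⟩
  pₑ + ∣ d - pₑ ∣ ≤⟨ +-mono-≤ p₀≤k close ⟩
  k + k          ≡⟨ cong (k +_) (+-identityʳ k) ⟨
  2 * k          ∎)
  where open ≤-Reasoning

far-pattern : ∀ {k d} → suc (2 * k) ≤ d → LinePattern k d (d / suc (2 * k))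
far-pattern {k} {d} m≤d with block-cover k (d / suc (2 * k)) d (d≤[d/m]*m+2k k d)
... | K , few , dom with dom 0 z≤n | dom d ≤-refl
...   | p₀ , p₀≤d , Kp₀ , p₀≤k | pₑ , pₑ≤d , Kpₑ , close = record
  { kept       = K
  ; few        = few
  ; dominating = dom
  ; resolving  = resolves-by-two p₀≤d pₑ≤d (ends-dominators-differ m≤d p₀≤k close) Kp₀ Kpₑ
  }

module _ {n : ℕ} where

  image : (ℕ → Fin n) → (ℕ → Bool) → ℕ → Subset n
  image x R zero    = ⊥
  image x R (suc t) = if R 0 then ⁅ x 0 ⁆ ∪ rest else rest
    where
    rest : Subset n
    rest = image (x ∘ suc) (R ∘ suc) t

  ∈-image⁻ : ∀ x R t {y} → y ∈ image x R t → ∃[ i ] i < t × R i ≡ true × x i ≡ y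
  ∈-image⁻ x R zero    y∈ = contradiction y∈ ∉⊥
  ∈-image⁻ x R (suc t) y∈ with R 0 in R0
  ... | false with ∈-image⁻ (x ∘ suc) (R ∘ suc) t y∈
  ...   | i , i<t , Ri , xi≡y = suc i , s≤s i<t , Ri , xi≡y
  ∈-image⁻ x R (suc t) y∈ | true with x∈p∪q⁻ ⁅ x 0 ⁆ (image (x ∘ suc) (R ∘ suc) t) y∈
  ...   | inj₁ y∈⁅x0⁆ = 0 , s≤s z≤n , R0 , sym (x∈⁅y⁆⇒x≡y (x 0) y∈⁅x0⁆)
  ...   | inj₂ y∈rest with ∈-image⁻ (x ∘ suc) (R ∘ suc) t y∈rest
  ...     | i , i<t , Ri , xi≡y = suc i , s≤s i<t , Ri , xi≡y

  InjectiveBelow : ℕ → (ℕ → Fin n) → Set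
  InjectiveBelow t x = ∀ {i j} → i < t → j < t → x i ≡ x j → i ≡ j

  InjectiveBelow-suc : ∀ {t x} → InjectiveBelow (suc t) x → InjectiveBelow t (x ∘ suc)
  InjectiveBelow-suc inj i<t j<t eq = suc-injective (inj (s≤s i<t) (s≤s j<t) eq)

  x∉p⇒∣p∣<∣⁅x⁆∪p∣ : ∀ {x : Fin n} {p : Subset n} → x ∉ p → ∣ p ∣ < ∣ ⁅ x ⁆ ∪ p ∣
  x∉p⇒∣p∣<∣⁅x⁆∪p∣ {x} {p} x∉p = p⊂q⇒∣p∣<∣q∣ (q⊆p∪q ⁅ x ⁆ p , x , x∈p∪q⁺ (inj₁ (x∈⁅x⁆ x)) , x∉p)

  count≤∣image∣ : ∀ x R t → InjectiveBelow t x → count R t ≤ ∣ image x R t ∣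
  count≤∣image∣ x R zero    inj = z≤n
  count≤∣image∣ x R (suc t) inj with R 0
  ... | false = count≤∣image∣ (x ∘ suc) (R ∘ suc) t (InjectiveBelow-suc inj)
  ... | true  = ≤-trans (s≤s (count≤∣image∣ (x ∘ suc) (R ∘ suc) t (InjectiveBelow-suc inj)))
                        (x∉p⇒∣p∣<∣⁅x⁆∪p∣ fresh)
    where
    fresh : x 0 ∉ image (x ∘ suc) (R ∘ suc) t
    fresh x0∈ with ∈-image⁻ (x ∘ suc) (R ∘ suc) t x0∈
    ... | i , i<t , _ , x[1+i]≡x0 with inj (s≤s i<t) (s≤s z≤n) x[1+i]≡x0
    ... | ()

module _ {n : ℕ} {G : Graph n} where

  infixr 5 _++ʷ_
  _++ʷ_ : ∀ {a b c l₁ l₂} → Walk G a b l₁ → Walk G b c l₂ → Walk G a c (l₁ + l₂)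
  nil      ++ʷ q = q
  cons e p ++ʷ q = cons e (p ++ʷ q)

  _∷ʳ_ : ∀ {a b c l} → Walk G a b l → Adj G b c → Walk G a c (suc l)
  nil      ∷ʳ e = cons e nil
  cons f p ∷ʳ e = cons f (p ∷ʳ e)

  reverseʷ : ∀ {a b l} → Walk G a b l → Walk G b a l
  reverseʷ nil        = nil
  reverseʷ (cons e p) = reverseʷ p ∷ʳ symm G e

  IsDist-sym : ∀ {a b e} → IsDist G a b e → IsDist G b a e
  IsDist-sym (p , shortest) = reverseʷ p , λ m q → shortest m (reverseʷ q)

  IsDist-unique : ∀ {a b e₁ e₂} → IsDist G a b e₁ → IsDist G a b e₂ → e₁ ≡ e₂
  IsDist-unique (p₁ , shortest₁) (p₂ , shortest₂) = ≤-antisym (shortest₁ _ p₂) (shortest₂ _ p₁)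

  vertexAt : ∀ {a b l} → Walk G a b l → ℕ → Fin n
  vertexAt {a} p          zero    = a
  vertexAt {a} nil        (suc i) = a
  vertexAt     (cons _ p) (suc i) = vertexAt p i

  takeʷ : ∀ {a b l} (p : Walk G a b l) {i} → i ≤ l → Walk G a (vertexAt p i) i
  takeʷ p          {zero}  _         = nil
  takeʷ (cons e p) {suc i} (s≤s i≤l) = cons e (takeʷ p i≤l)

  dropʷ : ∀ {a b l} (p : Walk G a b l) {i} → i ≤ l → Walk G (vertexAt p i) b (l ∸ i)
  dropʷ p          {zero}  _         = p
  dropʷ (cons e p) {suc i} (s≤s i≤l) = dropʷ p i≤l

  segmentʷ : ∀ {a b l} (p : Walk G a b l) {i j} → i ≤ j → j ≤ l →
             Walk G (vertexAt p i) (vertexAt p j) (j ∸ i)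
  segmentʷ p          {zero}          _         j≤l       = takeʷ p j≤l
  segmentʷ (cons e p) {suc i} {suc j} (s≤s i≤j) (s≤s j≤l) = segmentʷ p i≤j j≤l

detour-bound : ∀ {i j m d} → j ≤ d → d ≤ i + (m + (d ∸ j)) → j ∸ i ≤ m
detour-bound {i} {j} {m} {d} j≤d d≤ = m≤n+o⇒m∸n≤o j i (+-cancelʳ-≤ (d ∸ j) j (i + m) (begin
  j + (d ∸ j)         ≡⟨ m+[n∸m]≡n j≤d ⟩
  d                   ≤⟨ d≤ ⟩
  i + (m + (d ∸ j))   ≡⟨ +-assoc i m (d ∸ j) ⟨
  i + m + (d ∸ j)     ∎))
  where open ≤-Reasoning

module Geodesic {n} {G : Graph n} {u v d} (geodesic : IsDist G u v d) where

  vertex : ℕ → Fin n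
  vertex = vertexAt (proj₁ geodesic)

  segment-dist : ∀ {i j} → i ≤ j → j ≤ d → IsDist G (vertex i) (vertex j) (j ∸ i)
  segment-dist {i} {j} i≤j j≤d = segmentʷ γ i≤j j≤d , λ m q →
    detour-bound {i = i} j≤d (proj₂ geodesic _ (takeʷ γ (≤-trans i≤j j≤d) ++ʷ q ++ʷ dropʷ γ j≤d))
    where
    γ : Walk G u v d
    γ = proj₁ geodesic

  vertex-dist : ∀ {i j} → i ≤ d → j ≤ d → IsDist G (vertex i) (vertex j) ∣ i - j ∣
  vertex-dist {i} {j} i≤d j≤d with ≤-total i j
  ... | inj₁ i≤j = subst (IsDist G _ _) (sym (m≤n⇒∣m-n∣≡n∸m i≤j)) (segment-dist i≤j j≤d)
  ... | inj₂ j≤i = subst (IsDist G _ _) (sym (m≤n⇒∣n-m∣≡n∸m j≤i)) (IsDist-sym (segment-dist j≤i i≤d))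

  vertex-injective : InjectiveBelow (suc d) vertex
  vertex-injective {i} {j} (s≤s i≤d) (s≤s j≤d) eq = ∣m-n∣≡0⇒m≡n (n≤0⇒n≡0
    (proj₂ (vertex-dist i≤d j≤d) 0 (subst (λ y → Walk G y (vertex j) 0) (sym eq) nil)))

  module _ (K : ℕ → Bool) where

    retained : Subset n
    retained = ∁ (image vertex (not ∘ K) (suc d))

    ∣retained∣≤ : ∣ retained ∣ ≤ n ∸ count (not ∘ K) (suc d)
    ∣retained∣≤ = subst (_≤ _) (sym (∣∁p∣≡n∸∣p∣ (image vertex (not ∘ K) (suc d))))
      (∸-monoʳ-≤ n (count≤∣image∣ vertex (not ∘ K) (suc d) vertex-injective))

    ∉retained⇒on-path : ∀ {y} → y ∉ retained → ∃[ i ] i ≤ d × vertex i ≡ y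
    ∉retained⇒on-path y∉ with ∈-image⁻ vertex (not ∘ K) (suc d) (x∉∁p⇒x∈p y∉)
    ... | i , s≤s i≤d , _ , vertex-i≡y = i , i≤d , vertex-i≡y

    kept∈retained : ∀ {i} → i ≤ d → K i ≡ true → vertex i ∈ retained
    kept∈retained {i} i≤d Ki = x∉p⇒x∈∁p λ vertex-i∈ →
      let j , j<1+d , removed , vertex-j≡vertex-i = ∈-image⁻ vertex (not ∘ K) (suc d) vertex-i∈
          j≡i = vertex-injective j<1+d (s≤s i≤d) vertex-j≡vertex-i
      in  contradiction (trans (sym (subst (λ z → not (K z) ≡ true) j≡i removed)) (cong not Ki)) λ ()

    retained-resolving-dominating : ∀ {k} → Dominates k K d → Resolves K d →
      ResolvingKDominating G k retained
    retained-resolving-dominating {k} dom res = resolving , dominating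
      where
      resolving : Resolving G retained
      resolving a b a∉ b∉ a≢b with ∉retained⇒on-path a∉ | ∉retained⇒on-path b∉
      ... | i , i≤d , refl | j , j≤d , refl with res i j i≤d j≤d (λ i≡j → a≢b (cong vertex i≡j))
      ...   | c , c≤d , Kc , differ =
        vertex c , ∣ i - c ∣ , ∣ j - c ∣ , kept∈retained c≤d Kc ,
        vertex-dist i≤d c≤d , vertex-dist j≤d c≤d , differ

      dominating : DistKDominating G k retained
      dominating y y∉ with ∉retained⇒on-path y∉
      ... | i , i≤d , refl with dom i i≤d
      ...   | p , p≤d , Kp , close = vertex p , ∣ i - p ∣ , kept∈retained p≤d Kp , vertex-dist i≤d p≤d , close

  pattern-bound : ∀ {k c} → LinePattern k d c →
    Σ (Subset n) λ D → ResolvingKDominating G k D × ∣ D ∣ ≤ n ∸ (d ∸ c)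
  pattern-bound {c = c} P =
    retained kept , retained-resolving-dominating kept dominating resolving ,
    ≤-trans (∣retained∣≤ kept) (∸-monoʳ-≤ n (begin
      suc d ∸ suc c                ≤⟨ ∸-monoʳ-≤ (suc d) few ⟩
      suc d ∸ count kept (suc d)   ≡⟨ count-not kept (suc d) ⟨
      count (not ∘ kept) (suc d)   ∎))
    where
    open LinePattern P
    open ≤-Reasoning

diameter-bounds : ∀ k {n d} (G : Graph n) → Diameter G d →
  (d ≤ k → Σ (Subset n) λ D → ResolvingKDominating G k D × ∣ D ∣ ≤ n ∸ d)
  × (d ≤ 2 * k → Σ (Subset n) λ D → ResolvingKDominating G k D × ∣ D ∣ ≤ n ∸ d + 1)
  × (suc (2 * k) ≤ d →
      Σ (Subset n) λ D → ResolvingKDominating G k D × ∣ D ∣ ≤ n ∸ d + d / suc (2 * k))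
diameter-bounds k {n} {d} G ((_ , _ , geodesic) , _) =
  (λ d≤k → pattern-bound (near-pattern d≤k)) ,
  (λ d≤2k → relax (pattern-bound (middle-pattern d≤2k))) ,
  (λ m≤d → relax (pattern-bound (far-pattern m≤d)))
  where
  open Geodesic geodesic

  relax : ∀ {c} → (Σ (Subset n) λ D → ResolvingKDominating G k D × ∣ D ∣ ≤ n ∸ (d ∸ c)) →
                   Σ (Subset n) λ D → ResolvingKDominating G k D × ∣ D ∣ ≤ n ∸ d + c
  relax {c} (D , rk , ∣D∣≤) = D , rk , ≤-trans ∣D∣≤ (m∸[n∸o]≤m∸n+o n d c)

∣n-1+n∣≡1 : ∀ n → ∣ n - suc n ∣ ≡ 1
∣n-1+n∣≡1 zero    = refl
∣n-1+n∣≡1 (suc n) = ∣n-1+n∣≡1 n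

∣1+n-n∣≡1 : ∀ n → ∣ suc n - n ∣ ≡ 1
∣1+n-n∣≡1 n = trans (∣-∣-comm (suc n) n) (∣n-1+n∣≡1 n)

path-edge-length : ∀ {n} {a b : Fin n} → PathAdj a b → ∣ toℕ a - toℕ b ∣ ≡ 1
path-edge-length {a = a} (inj₁ b≡1+a) rewrite b≡1+a = ∣n-1+n∣≡1 (toℕ a)
path-edge-length {b = b} (inj₂ a≡1+b) rewrite a≡1+b = ∣1+n-n∣≡1 (toℕ b)

path-walk-length : ∀ {n} {a b : Fin n} {l} → Walk (Path n) a b l → ∣ toℕ a - toℕ b ∣ ≤ l
path-walk-length {a = a} nil = ≤-reflexive (∣n-n∣≡0 (toℕ a))
path-walk-length {a = a} {b} (cons {v = c} e p) = begin
  ∣ toℕ a - toℕ b ∣                       ≤⟨ ∣-∣-triangle (toℕ a) (toℕ c) (toℕ b) ⟩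
  ∣ toℕ a - toℕ c ∣ + ∣ toℕ c - toℕ b ∣   ≡⟨ cong (_+ ∣ toℕ c - toℕ b ∣) (path-edge-length e) ⟩
  suc ∣ toℕ c - toℕ b ∣                   ≤⟨ s≤s (path-walk-length p) ⟩
  suc _                                   ∎
  where open ≤-Reasoning

ascending-walk : ∀ {n} (a b : Fin n) t → toℕ a + t ≡ toℕ b → Walk (Path n) a b t
ascending-walk a b zero a+0≡b =
  subst (λ c → Walk (Path _) a c 0) (toℕ-injective (trans (sym (+-identityʳ (toℕ a))) a+0≡b)) nil
ascending-walk {n} a b (suc t) a+1+t≡b =
  cons (inj₁ (toℕ-fromℕ< 1+a<n)) (ascending-walk (fromℕ< 1+a<n) b t (trans (cong (_+ t) (toℕ-fromℕ< 1+a<n)) 1+a+t≡b))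
  where
  1+a+t≡b : suc (toℕ a + t) ≡ toℕ b
  1+a+t≡b = trans (sym (+-suc (toℕ a) t)) a+1+t≡b
  1+a<n : suc (toℕ a) < n
  1+a<n = ≤-<-trans (subst (suc (toℕ a) ≤_) 1+a+t≡b (s≤s (m≤m+n (toℕ a) t))) (toℕ<n b)

path-dist : ∀ {n} (a b : Fin n) → IsDist (Path n) a b ∣ toℕ a - toℕ b ∣
path-dist {n} a b = walk , λ _ → path-walk-length
  where
  walk : Walk (Path n) a b ∣ toℕ a - toℕ b ∣
  walk with ≤-total (toℕ a) (toℕ b)
  ... | inj₁ a≤b = subst (Walk (Path n) a b) (sym (m≤n⇒∣m-n∣≡n∸m a≤b))
                     (ascending-walk a b _ (m+[n∸m]≡n a≤b))
  ... | inj₂ b≤a = subst (Walk (Path n) a b) (sym (m≤n⇒∣n-m∣≡n∸m b≤a))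
                     (reverseʷ (ascending-walk b a _ (m+[n∸m]≡n b≤a)))

path-dist-at : ∀ {n} {a b : Fin n} {i j} → toℕ a ≡ i → toℕ b ≡ j → IsDist (Path n) a b ∣ i - j ∣
path-dist-at refl refl = path-dist _ _

path-diameter : ∀ m → Diameter (Path (suc m)) m
path-diameter m = (Fin.zero , fromℕ m , path-dist-at refl (toℕ-fromℕ m)) , λ a b e dist →
  begin
    e                   ≡⟨ IsDist-unique dist (path-dist a b) ⟩
    ∣ toℕ a - toℕ b ∣   ≤⟨ ∣m-n∣≤m⊔n (toℕ a) (toℕ b) ⟩
    toℕ a ⊔ toℕ b       ≤⟨ ⊔-lub (≤-pred (toℕ<n a)) (≤-pred (toℕ<n b)) ⟩
    m                   ∎
  where open ≤-Reasoning

module _ {n} {G : Graph n} {D : Subset n} where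

  dominating⇒member : ∀ {k} → DistKDominating G k D → Fin n → ∃[ w ] w ∈ D
  dominating⇒member dom y with y ∈? D
  ... | yes y∈ = y , y∈
  ... | no  y∉ = proj₁ (dom y y∉) , proj₁ (proj₂ (proj₂ (dom y y∉)))

  far-vertex⇒other-member : ∀ {k} → DistKDominating G k D → ∀ {y w e} → IsDist G y w e → k < e →
    ∃[ w′ ] w′ ∈ D × w′ ≢ w
  far-vertex⇒other-member {k} dom {y} dist k<e with y ∈? D
  ... | yes y∈ = y , y∈ , λ { refl → contradiction (≤-trans k<e (proj₂ dist 0 nil)) λ () }
  ... | no  y∉ with dom y y∉
  ...   | c , e′ , c∈ , dist′ , e′≤k =
    c , c∈ , λ { refl → <⇒≱ k<e (subst (_≤ k) (IsDist-unique dist′ dist) e′≤k) }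

  equidistant-pair⇒other-member : Resolving G D → ∀ {y₁ y₂ w e} → y₁ ≢ y₂ → y₁ ≢ w → y₂ ≢ w →
    IsDist G y₁ w e → IsDist G y₂ w e → ∃[ w′ ] w′ ∈ D × w′ ≢ w
  equidistant-pair⇒other-member res {y₁} {y₂} y₁≢y₂ y₁≢w y₂≢w dist₁ dist₂ with y₁ ∈? D | y₂ ∈? D
  ... | yes y₁∈ | _       = y₁ , y₁∈ , y₁≢w
  ... | no  _   | yes y₂∈ = y₂ , y₂∈ , y₂≢w
  ... | no  y₁∉ | no  y₂∉ with res y₁ y₂ y₁∉ y₂∉ y₁≢y₂
  ...   | c , e₁ , e₂ , c∈ , dist₁′ , dist₂′ , e₁≢e₂ =
    c , c∈ , λ { refl → e₁≢e₂ (trans (IsDist-unique dist₁′ dist₁) (IsDist-unique dist₂ dist₂′)) }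

module _ {n} {D : Subset n} where

  x∈D⇒⁅x⁆⊆D : ∀ {w} → w ∈ D → ⁅ w ⁆ ⊆ D
  x∈D⇒⁅x⁆⊆D {w} w∈ y∈⁅w⁆ = subst (_∈ D) (sym (x∈⁅y⁆⇒x≡y w y∈⁅w⁆)) w∈

  member⇒1≤∣D∣ : ∀ {w} → w ∈ D → 1 ≤ ∣ D ∣
  member⇒1≤∣D∣ {w} w∈ = subst (_≤ ∣ D ∣) (∣⁅x⁆∣≡1 w) (p⊆q⇒∣p∣≤∣q∣ (x∈D⇒⁅x⁆⊆D w∈))

  two-members⇒2≤∣D∣ : ∀ {w w′} → w ∈ D → w′ ∈ D → w′ ≢ w → 2 ≤ ∣ D ∣
  two-members⇒2≤∣D∣ {w} {w′} w∈ w′∈ w′≢w = subst (_< ∣ D ∣) (∣⁅x⁆∣≡1 w)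
    (p⊂q⇒∣p∣<∣q∣ (x∈D⇒⁅x⁆⊆D w∈ , w′ , w′∈ , λ w′∈⁅w⁆ → w′≢w (x∈⁅y⁆⇒x≡y w w′∈⁅w⁆)))

toℕ-≢ : ∀ {n} {a b : Fin n} {i j} → toℕ a ≡ i → toℕ b ≡ j → i ≢ j → a ≢ b
toℕ-≢ refl refl i≢j a≡b = i≢j (cong toℕ a≡b)

-- An endpoint is farther than k from the other endpoint, and an interior
-- vertex cannot tell its two neighbours apart.
path-other-member : ∀ {m k} {D : Subset (suc (suc m))} → k ≤ m →
  ResolvingKDominating (Path (suc (suc m))) k D → ∀ w → ∃[ w′ ] w′ ∈ D × w′ ≢ w
path-other-member {m} k≤m (_ , dom) Fin.zero =
  far-vertex⇒other-member dom (path-dist-at (toℕ-fromℕ (suc m)) refl) (s≤s k≤m)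
path-other-member {m} k≤m (res , dom) (Fin.suc v) with toℕ v ≟ m
... | yes v≡m = far-vertex⇒other-member dom (path-dist-at {a = Fin.zero} refl (cong suc v≡m)) (s≤s k≤m)
... | no  v≢m = equidistant-pair⇒other-member res
  (toℕ-≢ below above (<⇒≢ (m<n⇒m<1+n (n<1+n (toℕ v)))))
  (toℕ-≢ {b = Fin.suc v} below refl (<⇒≢ (n<1+n (toℕ v))))
  (toℕ-≢ {b = Fin.suc v} above refl (>⇒≢ (n<1+n (suc (toℕ v)))))
  (subst (IsDist _ _ _) (∣n-1+n∣≡1 (toℕ v)) (path-dist-at {b = Fin.suc v} below refl))
  (subst (IsDist _ _ _) (∣1+n-n∣≡1 (toℕ v)) (path-dist-at {b = Fin.suc v} above refl))
  where
  v+2<m+2 : suc (suc (toℕ v)) < suc (suc m)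
  v+2<m+2 = s≤s (s≤s (≤∧≢⇒< (≤-pred (toℕ<n v)) v≢m))
  below : toℕ (inject₁ v) ≡ toℕ v
  below = toℕ-inject₁ v
  above : toℕ (fromℕ< v+2<m+2) ≡ suc (suc (toℕ v))
  above = toℕ-fromℕ< v+2<m+2

path-2≤∣D∣ : ∀ {m k} {D : Subset (suc (suc m))} → k ≤ m →
  ResolvingKDominating (Path (suc (suc m))) k D → 2 ≤ ∣ D ∣
path-2≤∣D∣ k≤m rk =
  let w , w∈ = dominating⇒member (proj₂ rk) Fin.zero
      w′ , w′∈ , w′≢w = path-other-member k≤m rk w
  in  two-members⇒2≤∣D∣ w∈ w′∈ w′≢w

IsGammaRK-from-bounds : ∀ {n} {G : Graph n} {k v} →
  (Σ (Subset n) λ D → ResolvingKDominating G k D × ∣ D ∣ ≤ v) →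
  (∀ D → ResolvingKDominating G k D → v ≤ ∣ D ∣) → IsGammaRK G k v
IsGammaRK-from-bounds (D , rk , ∣D∣≤v) lower = (D , rk , ≤-antisym ∣D∣≤v (lower D rk)) , lower

path-attains-near : ∀ k →
  Σ ℕ λ n → Σ ℕ λ d → Diameter (Path n) d × d ≤ k × IsGammaRK (Path n) k (n ∸ d)
path-attains-near k = 1 , 0 , path-diameter 0 , z≤n ,
  IsGammaRK-from-bounds (proj₁ (diameter-bounds k (Path 1) (path-diameter 0)) z≤n)
    (λ D rk → member⇒1≤∣D∣ (proj₂ (dominating⇒member (proj₂ rk) Fin.zero)))

path-attains-middle : ∀ {k} → 1 ≤ k →
  Σ ℕ λ n → Σ ℕ λ d → Diameter (Path n) d × suc k ≤ d × d ≤ 2 * k × IsGammaRK (Path n) k (n ∸ d + 1)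
path-attains-middle {k} 1≤k = suc (suc k) , suc k , path-diameter (suc k) , ≤-refl , 1+k≤2k ,
  IsGammaRK-from-bounds (proj₁ (proj₂ (diameter-bounds k (Path (suc (suc k))) (path-diameter (suc k)))) 1+k≤2k)
    (λ D rk → subst (_≤ ∣ D ∣) (sym (cong (_+ 1) (m+n∸n≡m 1 (suc k)))) (path-2≤∣D∣ ≤-refl rk))
  where
  1+k≤2k : suc k ≤ 2 * k
  1+k≤2k = subst (_≤ 2 * k) (+-comm k 1) (+-monoʳ-≤ k (≤-trans 1≤k (m≤m+n k 0)))

path-attains-far : ∀ k →
  Σ ℕ λ n → Σ ℕ λ d → Diameter (Path n) d × suc (2 * k) ≤ d
    × IsGammaRK (Path n) k (n ∸ d + d / suc (2 * k))
path-attains-far k = suc m , m , path-diameter m , ≤-refl ,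
  IsGammaRK-from-bounds (proj₂ (proj₂ (diameter-bounds k (Path (suc m)) (path-diameter m))) ≤-refl)
    (λ D rk → subst (_≤ ∣ D ∣) (sym (cong₂ _+_ (m+n∸n≡m 1 m) (n/n≡1 m))) (path-2≤∣D∣ (m≤m+n k (k + 0)) rk))
  where
  m : ℕ
  m = suc (2 * k)

proposition2p6 :
    ((k n d : ℕ) (G : Graph n) → 1 ≤ k → Connected G → Diameter G d →
      (d ≤ k → Σ (Subset n) λ D → ResolvingKDominating G k D × ∣ D ∣ ≤ n ∸ d)
      × (suc k ≤ d → d ≤ 2 * k →
          Σ (Subset n) λ D → ResolvingKDominating G k D × ∣ D ∣ ≤ n ∸ d + 1)
      × (suc (2 * k) ≤ d →
          Σ (Subset n) λ D → ResolvingKDominating G k D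
            × ∣ D ∣ ≤ n ∸ d + d / suc (2 * k)))
    × ((k : ℕ) → 1 ≤ k →
      (Σ ℕ λ n → Σ ℕ λ d → Diameter (Path n) d × d ≤ k
          × IsGammaRK (Path n) k (n ∸ d))
      × (Σ ℕ λ n → Σ ℕ λ d → Diameter (Path n) d × suc k ≤ d × d ≤ 2 * k
          × IsGammaRK (Path n) k (n ∸ d + 1))
      × (Σ ℕ λ n → Σ ℕ λ d → Diameter (Path n) d × suc (2 * k) ≤ d
          × IsGammaRK (Path n) k (n ∸ d + d / suc (2 * k))))
proposition2p6 =
  (λ k n d G _ _ diameter →
    let near , middle , far = diameter-bounds k G diameter in near , (λ _ → middle) , far) ,
  (λ k 1≤k → path-attains-near k , path-attains-middle 1≤k , path-attains-far k)
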